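{- For $n$ voters, the number of proper linear games having exactly one shift-minimal winning coalition is $2^n-\binom{n}{\lfloor n/2\rfloor}$. Moreover, for a coalition $A\subseteq N=\{1,\dots,n\}$, the linear game $\langle A\rangle$ is proper if and only if there is some $k\le n$ such that $A$ contains $k$ of the $2k-1$ largest elements of $N$.
   Context: A simple game on $N=\{1,\dots,n\}$ is a family $W$ of subsets of $N$ (winning coalitions) with $N\in W$, $\emptyset\notin W$, closed under supersets. Order subsets of $N$ by: for $A=\{a_1>\dots>a_k\}$, $B=\{b_1>\dots>b_j\}$, $B\ge A$ iff $k\le j$ and $b_i\ge a_i$ for $i\le k$. A linear game is a simple game whose winning set is an up-set for this order; its shift-minimal winning coalitions are the minimal elements of its winning set. For a coalition $A$, $\langle A\rangle$ denotes the linear game whose winning coalitions are all $B$ with $B\ge A$. A game is proper if no coalition and its complement are both winning. -}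

module Defs where

open import Data.Bool using (Bool; true; false; T)
open import Data.Nat using (ℕ; zero; suc; _∸_; _≤ᵇ_; _≤_)
open import Data.Fin using (Fin; toℕ) renaming (_≤_ to _≤ꟳ_; _≤?_ to _≤ꟳ?_)
open import Data.Fin.Subset using (Subset; ⊤; ⊥; _⊆_; ∁; _∩_; ∣_∣)
open import Data.List using (List; []; _∷_; map; reverse)
open import Data.Vec using ([]; _∷_; tabulate)
open import Data.Product using (Σ; _×_; _,_)
open import Data.Unit using () renaming (⊤ to Unit; tt to unit)
open import Data.Empty using () renaming (⊥ to Empty)
open import Relation.Nullary using (Dec; yes; no; ¬_; does)
open import Relation.Binary.PropositionalEquality using (_≡_)

-- Voter number v ∈ {1,…,n} is represented by the index i : Fin n with toℕ i + 1 = v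
-- (this is order preserving). A coalition is a Subset n (= Vec Bool n).

elemsAsc : ∀ {n} → Subset n → List (Fin n)
elemsAsc [] = []
elemsAsc (true ∷ p) = Fin.zero ∷ map Fin.suc (elemsAsc p)
elemsAsc (false ∷ p) = map Fin.suc (elemsAsc p)

elemsDesc : ∀ {n} → Subset n → List (Fin n)
elemsDesc p = reverse (elemsAsc p)

DomList : ∀ {n} → List (Fin n) → List (Fin n) → Set
DomList [] _ = Unit
DomList (a ∷ as) [] = Empty
DomList (a ∷ as) (b ∷ bs) = (a ≤ꟳ b) × DomList as bs

domList? : ∀ {n} (as bs : List (Fin n)) → Dec (DomList as bs)
domList? [] _ = yes unit
domList? (a ∷ as) [] = no (λ ())
domList? (a ∷ as) (b ∷ bs) with a ≤ꟳ? b | domList? as bs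
... | yes p | yes q = yes (p , q)
... | no ¬p | _ = no (λ { (p , _) → ¬p p })
... | yes _ | no ¬q = no (λ { (_ , q) → ¬q q })

infix 4 _≽_
_≽_ : ∀ {n} → Subset n → Subset n → Set
B ≽ A = DomList (elemsDesc A) (elemsDesc B)

Family : ℕ → Set
Family n = Subset n → Bool

IsSimpleGame : ∀ {n} → Family n → Set
IsSimpleGame W =
  (W ⊤ ≡ true) × (W ⊥ ≡ false) ×
  (∀ A B → A ⊆ B → W A ≡ true → W B ≡ true)

IsLinearGame : ∀ {n} → Family n → Set
IsLinearGame W = IsSimpleGame W × (∀ A B → B ≽ A → W A ≡ true → W B ≡ true)

IsShiftMinimalWinning : ∀ {n} → Family n → Subset n → Set
IsShiftMinimalWinning W A = (W A ≡ true) × (∀ B → W B ≡ true → A ≽ B → B ≡ A)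

HasExactlyOneShiftMinimalWinning : ∀ {n} → Family n → Set
HasExactlyOneShiftMinimalWinning W =
  Σ _ λ A → IsShiftMinimalWinning W A × (∀ B → IsShiftMinimalWinning W B → B ≡ A)

IsProper : ∀ {n} → Family n → Set
IsProper W = ∀ A → W A ≡ true → ¬ (W (∁ A) ≡ true)

⟨_⟩ : ∀ {n} → Subset n → Family n
⟨ A ⟩ B = does (domList? (elemsDesc A) (elemsDesc B))

_≐_ : ∀ {n} → Family n → Family n → Set
F ≐ G = ∀ S → F S ≡ G S

-- "The number of families satisfying P is m" (families counted up to extensional equality):
-- an enumeration by Fin m of families satisfying P, injective up to ≐, and covering
-- every family satisfying P up to ≐.
HasCount : ∀ {n} → (Family n → Set) → ℕ → Set
HasCount {n} P m =
  Σ (Fin m → Family n) λ f →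
    (∀ i → P (f i)) ×
    (∀ i j → f i ≐ f j → i ≡ j) ×
    (∀ F → P F → Σ (Fin m) λ i → F ≐ f i)

-- The set of the m largest elements of N (all of N when m ≥ n).
largest : (n m : ℕ) → Subset n
largest n m = tabulate λ i → (n ∸ m) ≤ᵇ toℕ i

-- Write ∣ A ∣≥ t for the number of members of A among the voters with index ≥ t. The
-- desirability order is then the pointwise order: B ≽ A iff ∣ A ∣≥ t ≤ ∣ B ∣≥ t for all t.
-- Every winning coalition dominates a shift-minimal one (descent on Σₜ ∣ S ∣≥ t), so a linear
-- game whose only shift-minimal winning coalition is A is ⟨ A ⟩. The game ⟨ A ⟩ is proper iff
-- A holds a strict majority of some top segment of voters: S and ∁ S cannot both match that
-- majority, while if there is none, A is dominated both by an alternating coalition and by its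
-- complement. With k = ∣ A ∣≥ t this is the paper's condition on the 2k − 1 largest voters.
-- The coalitions without such a majority are ballot sequences: splitting on the lowest voter,
-- those with at most j members (2j ≤ n) obey Pascal's rule, so there are C(n, j) of them and
-- C(n, ⌊n/2⌋) in all; the proper games ⟨ A ⟩ are counted by the complement.

module Submission where

open import Defs
open import Data.Nat using (ℕ; _≤_; _^_; _∸_; _*_; _/_)
open import Data.Nat.Combinatorics using (_C_)
open import Data.Fin.Subset using (Subset; _∩_; ∣_∣)
open import Data.Product using (Σ; _×_)
open import Function.Bundles using (_⇔_)

open import Data.Bool using (Bool; true; false; if_then_else_)
open import Data.Bool.Properties as Bool using ()
open import Data.Empty using (⊥-elim)
open import Data.Fin as Fin using (Fin; toℕ; splitAt; join)
open import Data.Fin.Properties using (join-splitAt; splitAt-join)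
open import Data.Fin.Subset using (inside; outside; _⊆_; ∁; ⊤; ⊥)
open import Data.Fin.Subset.Properties using (drop-∷-⊆; ⊆⊤; ⊥⊆; anySubset?)
open import Data.List as List using (List; []; _∷_; _++_; [_]; length)
open import Data.List.Properties using (length-map; reverse-map; unfold-reverse)
open import Data.List.Relation.Unary.All as All using (All; []; _∷_)
open import Data.List.Relation.Unary.All.Properties as All using ()
open import Data.List.Relation.Unary.AllPairs as AllPairs using (AllPairs; []; _∷_)
open import Data.List.Relation.Unary.AllPairs.Properties as AllPairs using ()
open import Data.Nat using (zero; suc; _+_; _<_; _≤ᵇ_; z≤n; s≤s; z<s; s<s; s≤s⁻¹)
open import Data.Nat.Combinatorics using (nCk≡nC[n∸k]; nCk+nC[k+1]≡[n+1]C[k+1])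
open import Data.Nat.DivMod using (m*n/n≡m; m/n*n≤m; /-monoˡ-≤)
open import Data.Nat.Induction using (<-wellFounded)
open import Data.Nat.Properties
open import Data.Product using (∃-syntax; _,_; proj₁; proj₂)
open import Data.Sum using (_⊎_; inj₁; inj₂)
open import Data.Unit using (tt)
open import Data.Vec using (_∷_; []; tabulate; here)
open import Data.Vec.Properties using (∷-injectiveˡ; ∷-injectiveʳ; ≡-dec)
open import Function using (_∘_)
open import Function.Bundles using (mk⇔; Equivalence)
open import Function.Properties.Equivalence as ⇔ using ()
open import Induction.WellFounded using (Acc; acc)
open import Level using (Level)
open import Relation.Binary.PropositionalEquality hiding ([_])
open import Relation.Nullary using (Dec; yes; no; ¬_; does)
open import Relation.Nullary.Decidable as Dec using (does-⇔; ¬?; dec-true; _×-dec_; decidable-stable)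
open import Relation.Unary using (Pred; Decidable)
open import Algebra.Properties.CommutativeSemigroup +-commutativeSemigroup using (interchange)

private
  variable
    ℓ : Level
    n : ℕ

count : {P : Pred (Subset n) ℓ} → Decidable P → ℕ
count {zero}  P? = if does (P? []) then 1 else 0
count {suc n} P? = count (P? ∘ (inside ∷_)) + count (P? ∘ (outside ∷_))

enumerate : {P : Pred (Subset n) ℓ} (P? : Decidable P) → Fin (count P?) → Subset n

enumerate-∷ : {P : Pred (Subset (suc n)) ℓ} (P? : Decidable P) →
              Fin (count (P? ∘ (inside ∷_))) ⊎ Fin (count (P? ∘ (outside ∷_))) → Subset (suc n)
enumerate-∷ P? (inj₁ i) = inside ∷ enumerate (P? ∘ (inside ∷_)) i
enumerate-∷ P? (inj₂ i) = outside ∷ enumerate (P? ∘ (outside ∷_)) i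

enumerate {zero}  P? i = []
enumerate {suc n} P? = enumerate-∷ P? ∘ splitAt (count (P? ∘ (inside ∷_)))

enumerate-sound : {P : Pred (Subset n) ℓ} (P? : Decidable P) (i : Fin (count P?)) → P (enumerate P? i)
enumerate-sound {zero} P? i with P? []
... | yes p = p
enumerate-sound {suc n} P? i with splitAt (count (P? ∘ (inside ∷_))) i
... | inj₁ j = enumerate-sound (P? ∘ (inside ∷_)) j
... | inj₂ j = enumerate-sound (P? ∘ (outside ∷_)) j

enumerate-injective : {P : Pred (Subset n) ℓ} (P? : Decidable P) {i j : Fin (count P?)} →
                      enumerate P? i ≡ enumerate P? j → i ≡ j
enumerate-injective {zero} P? {i} {j} _ with P? []
enumerate-injective {zero} P? {Fin.zero} {Fin.zero} _ | yes _ = refl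
enumerate-injective {suc n} P? {i} {j} eq = begin
  i                                ≡⟨ join-splitAt c₁ c₂ i ⟨
  join c₁ c₂ (splitAt c₁ i)        ≡⟨ cong (join c₁ c₂) (branches-injective (splitAt c₁ i) (splitAt c₁ j) eq) ⟩
  join c₁ c₂ (splitAt c₁ j)        ≡⟨ join-splitAt c₁ c₂ j ⟩
  j                                ∎
  where
  open ≡-Reasoning
  c₁ = count (P? ∘ (inside ∷_))
  c₂ = count (P? ∘ (outside ∷_))
  branches-injective : ∀ x y → enumerate-∷ P? x ≡ enumerate-∷ P? y → x ≡ y
  branches-injective (inj₁ a) (inj₁ b) e = cong inj₁ (enumerate-injective _ (∷-injectiveʳ e))
  branches-injective (inj₂ a) (inj₂ b) e = cong inj₂ (enumerate-injective _ (∷-injectiveʳ e))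
  branches-injective (inj₁ a) (inj₂ b) e with () ← ∷-injectiveˡ e
  branches-injective (inj₂ a) (inj₁ b) e with () ← ∷-injectiveˡ e

enumerate-complete : {P : Pred (Subset n) ℓ} (P? : Decidable P) {v : Subset n} → P v →
                     ∃[ i ] enumerate P? i ≡ v
enumerate-complete {zero} P? {[]} p with P? []
... | yes _ = Fin.zero , refl
... | no ¬p = ⊥-elim (¬p p)
enumerate-complete {suc n} P? {inside ∷ v} p
  with i , refl ← enumerate-complete (P? ∘ (inside ∷_)) p =
  join c₁ c₂ (inj₁ i) , cong (enumerate-∷ P?) (splitAt-join c₁ c₂ (inj₁ i))
  where c₁ = count (P? ∘ (inside ∷_)); c₂ = count (P? ∘ (outside ∷_))
enumerate-complete {suc n} P? {outside ∷ v} p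
  with i , refl ← enumerate-complete (P? ∘ (outside ∷_)) p =
  join c₁ c₂ (inj₂ i) , cong (enumerate-∷ P?) (splitAt-join c₁ c₂ (inj₂ i))
  where c₁ = count (P? ∘ (inside ∷_)); c₂ = count (P? ∘ (outside ∷_))

count-cong : {P Q : Pred (Subset n) ℓ} (P? : Decidable P) (Q? : Decidable Q) →
             (∀ v → P v ⇔ Q v) → count P? ≡ count Q?
count-cong {zero}  P? Q? P⇔Q = cong (λ b → if b then 1 else 0) (does-⇔ (P⇔Q []) (P? []) (Q? []))
count-cong {suc n} P? Q? P⇔Q =
  cong₂ _+_ (count-cong _ _ (P⇔Q ∘ (inside ∷_))) (count-cong _ _ (P⇔Q ∘ (outside ∷_)))

count-empty : {P : Pred (Subset n) ℓ} (P? : Decidable P) → (∀ v → ¬ P v) → count P? ≡ 0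
count-empty {zero} P? ∄ with P? []
... | yes p = ⊥-elim (∄ [] p)
... | no _ = refl
count-empty {suc n} P? ∄ =
  cong₂ _+_ (count-empty _ (∄ ∘ (inside ∷_))) (count-empty _ (∄ ∘ (outside ∷_)))

count+count-¬≡2^n : {P : Pred (Subset n) ℓ} (P? : Decidable P) → count P? + count (¬? ∘ P?) ≡ 2 ^ n
count+count-¬≡2^n {zero} P? with P? []
... | yes _ = refl
... | no _ = refl
count+count-¬≡2^n {suc n} P? = begin
  (a + b) + (a′ + b′)   ≡⟨ interchange a b a′ b′ ⟩
  (a + a′) + (b + b′)   ≡⟨ cong₂ _+_ (count+count-¬≡2^n (P? ∘ (inside ∷_))) (count+count-¬≡2^n (P? ∘ (outside ∷_))) ⟩
  2 ^ n + 2 ^ n         ≡⟨ cong (2 ^ n +_) (+-identityʳ (2 ^ n)) ⟨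
  2 ^ suc n             ∎
  where
  open ≡-Reasoning
  a = count (P? ∘ (inside ∷_));  a′ = count (¬? ∘ P? ∘ (inside ∷_))
  b = count (P? ∘ (outside ∷_)); b′ = count (¬? ∘ P? ∘ (outside ∷_))

hasCount-parametrised : {P : Family n → Set} {Q : Pred (Subset n) ℓ} (Q? : Decidable Q) (f : Subset n → Family n) →
                        (∀ {A} → Q A → P (f A)) → (∀ {A B} → f A ≐ f B → A ≡ B) →
                        (∀ F → P F → ∃[ A ] Q A × F ≐ f A) → HasCount P (count Q?)
hasCount-parametrised Q? f Q⇒P f-injective P⇒Q =
  f ∘ enumerate Q? ,
  (λ i → Q⇒P (enumerate-sound Q? i)) ,
  (λ i j fi≐fj → enumerate-injective Q? (f-injective fi≐fj)) ,
  λ F PF → let A , QA , F≐fA = P⇒Q F PF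
               i , eᵢ≡A     = enumerate-complete Q? QA
           in i , λ S → trans (F≐fA S) (cong (λ B → f B S) (sym eᵢ≡A))

infix 8 ∣_∣≥_

∣_∣≥_ : Subset n → ℕ → ℕ
∣ []          ∣≥ t     = 0
∣ _       ∷ A ∣≥ suc t = ∣ A ∣≥ t
∣ inside  ∷ A ∣≥ zero  = suc (∣ A ∣≥ zero)
∣ outside ∷ A ∣≥ zero  = ∣ A ∣≥ zero

∣∣≥-mono-⊆ : {A B : Subset n} → A ⊆ B → ∀ t → ∣ A ∣≥ t ≤ ∣ B ∣≥ t
∣∣≥-mono-⊆ {A = []}          {[]}          _   t       = z≤n
∣∣≥-mono-⊆ {A = inside ∷ _}  {inside ∷ _}  A⊆B zero    = s≤s (∣∣≥-mono-⊆ (drop-∷-⊆ A⊆B) zero)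
∣∣≥-mono-⊆ {A = inside ∷ _}  {outside ∷ _} A⊆B zero    with () ← A⊆B here
∣∣≥-mono-⊆ {A = outside ∷ _} {inside ∷ _}  A⊆B zero    = m≤n⇒m≤1+n (∣∣≥-mono-⊆ (drop-∷-⊆ A⊆B) zero)
∣∣≥-mono-⊆ {A = outside ∷ _} {outside ∷ _} A⊆B zero    = ∣∣≥-mono-⊆ (drop-∷-⊆ A⊆B) zero
∣∣≥-mono-⊆ {A = _ ∷ _}       {_ ∷ _}       A⊆B (suc t) = ∣∣≥-mono-⊆ (drop-∷-⊆ A⊆B) t

∣∣≥-antitone : (A : Subset n) {s t : ℕ} → s ≤ t → ∣ A ∣≥ t ≤ ∣ A ∣≥ s
∣∣≥-antitone []            _       = z≤n
∣∣≥-antitone (_ ∷ A)       {zero}  {zero}  _ = ≤-refl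
∣∣≥-antitone (inside ∷ A)  {zero}  {suc t} _ = m≤n⇒m≤1+n (∣∣≥-antitone A z≤n)
∣∣≥-antitone (outside ∷ A) {zero}  {suc t} _ = ∣∣≥-antitone A z≤n
∣∣≥-antitone (_ ∷ A)       {suc s} {suc t} (s≤s s≤t) = ∣∣≥-antitone A s≤t

∣∣≥≤∸ : (A : Subset n) (t : ℕ) → ∣ A ∣≥ t ≤ n ∸ t
∣∣≥≤∸ []            t       = z≤n
∣∣≥≤∸ (inside ∷ A)  zero    = s≤s (∣∣≥≤∸ A zero)
∣∣≥≤∸ (outside ∷ A) zero    = m≤n⇒m≤1+n (∣∣≥≤∸ A zero)
∣∣≥≤∸ (_ ∷ A)       (suc t) = ∣∣≥≤∸ A t

∣∣≥+∣∁∣≥ : (A : Subset n) (t : ℕ) → ∣ A ∣≥ t + ∣ ∁ A ∣≥ t ≡ n ∸ t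
∣∣≥+∣∁∣≥ []            t       = sym (0∸n≡0 t)
∣∣≥+∣∁∣≥ (inside ∷ A)  zero    = cong suc (∣∣≥+∣∁∣≥ A zero)
∣∣≥+∣∁∣≥ (outside ∷ A) zero    = trans (+-suc (∣ A ∣≥ zero) _) (cong suc (∣∣≥+∣∁∣≥ A zero))
∣∣≥+∣∁∣≥ (_ ∷ A)       (suc t) = ∣∣≥+∣∁∣≥ A t

∣∩largest∣ : (A : Subset n) (m : ℕ) → ∣ A ∩ largest n m ∣ ≡ ∣ A ∣≥ (n ∸ m)
∣∩largest∣ {n} A m = ∣∩from∣ A (n ∸ m)
  where
  -- suc t ≤ᵇ suc m unfolds to t <ᵇ suc m, which agrees with t ≤ᵇ m only once t is split.
  ∣∩from∣ : ∀ {k} (A : Subset k) t → ∣ A ∩ tabulate (λ i → t ≤ᵇ toℕ i) ∣ ≡ ∣ A ∣≥ t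
  ∣∩from∣ []            t             = refl
  ∣∩from∣ (inside ∷ A)  zero          = cong suc (∣∩from∣ A zero)
  ∣∩from∣ (outside ∷ A) zero          = ∣∩from∣ A zero
  ∣∩from∣ (inside ∷ A)  (suc zero)    = ∣∩from∣ A zero
  ∣∩from∣ (outside ∷ A) (suc zero)    = ∣∩from∣ A zero
  ∣∩from∣ (inside ∷ A)  (suc (suc t)) = ∣∩from∣ A (suc t)
  ∣∩from∣ (outside ∷ A) (suc (suc t)) = ∣∩from∣ A (suc t)

count≥ : ℕ → List (Fin n) → ℕ
count≥ t []       = 0
count≥ t (a ∷ as) with t ≤? toℕ a
... | yes _ = suc (count≥ t as)
... | no  _ = count≥ t as

count≥-++ : (t : ℕ) (xs ys : List (Fin n)) → count≥ t (xs ++ ys) ≡ count≥ t xs + count≥ t ys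
count≥-++ t []       ys = refl
count≥-++ t (x ∷ xs) ys with t ≤? toℕ x
... | yes _ = cong suc (count≥-++ t xs ys)
... | no  _ = count≥-++ t xs ys

count≥-zero : (as : List (Fin n)) → count≥ 0 as ≡ length as
count≥-zero []       = refl
count≥-zero (a ∷ as) = cong suc (count≥-zero as)

count≥-suc-map : (t : ℕ) (as : List (Fin n)) → count≥ (suc t) (List.map Fin.suc as) ≡ count≥ t as
count≥-suc-map t []       = refl
count≥-suc-map t (a ∷ as) with t ≤? toℕ a | suc t ≤? suc (toℕ a)
... | yes _   | yes _ = cong suc (count≥-suc-map t as)
... | no  _   | no  _ = count≥-suc-map t as
... | yes t≤a | no  t≰a = ⊥-elim (t≰a (s≤s t≤a))
... | no  t≰a | yes t≤a = ⊥-elim (t≰a (s≤s⁻¹ t≤a))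

count≥-zero-map : (as : List (Fin n)) → count≥ 0 (List.map Fin.suc as) ≡ count≥ 0 as
count≥-zero-map as = trans (count≥-zero (List.map Fin.suc as)) (trans (length-map Fin.suc as) (sym (count≥-zero as)))

count≥-below : {t : ℕ} {as : List (Fin n)} → All (λ a → toℕ a < t) as → count≥ t as ≡ 0
count≥-below {t = t} [] = refl
count≥-below {t = t} {a ∷ as} (a<t ∷ as<t) with t ≤? toℕ a
... | yes t≤a = ⊥-elim (<⇒≱ a<t t≤a)
... | no  _   = count≥-below as<t

count≥-∷-≤ : {t : ℕ} {a : Fin n} (as : List (Fin n)) → t ≤ toℕ a → count≥ t (a ∷ as) ≡ suc (count≥ t as)
count≥-∷-≤ {t = t} {a} as t≤a with t ≤? toℕ a
... | yes _   = refl
... | no  t≰a = ⊥-elim (t≰a t≤a)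

count≥-∷-> : {t : ℕ} {a : Fin n} (as : List (Fin n)) → toℕ a < t → count≥ t (a ∷ as) ≡ count≥ t as
count≥-∷-> {t = t} {a} as a<t with t ≤? toℕ a
... | yes t≤a = ⊥-elim (<⇒≱ a<t t≤a)
... | no  _   = refl

count≥-below-head : {t : ℕ} {a : Fin n} {as : List (Fin n)} → AllPairs Fin._>_ (a ∷ as) → toℕ a < t →
                    count≥ t as ≡ 0
count≥-below-head (as<a ∷ _) a<t = count≥-below (All.map (λ x<a → <-trans x<a a<t) as<a)

domList⇒count≥ : {as bs : List (Fin n)} → AllPairs Fin._>_ as → DomList as bs →
                 ∀ t → count≥ t as ≤ count≥ t bs
domList⇒count≥ {as = []} _ _ t = z≤n
domList⇒count≥ {as = a ∷ as} {b ∷ bs} as↓@(_ ∷ as↓′) (a≤b , dom) t with t ≤? toℕ a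
... | no  t≰a = ≤-trans (≤-reflexive (count≥-below-head as↓ (≰⇒> t≰a))) z≤n
... | yes t≤a = begin
  suc (count≥ t as)   ≤⟨ s≤s (domList⇒count≥ as↓′ dom t) ⟩
  suc (count≥ t bs)   ≡⟨ count≥-∷-≤ bs (≤-trans t≤a a≤b) ⟨
  count≥ t (b ∷ bs)   ∎
  where open ≤-Reasoning

count≥⇒domList : {as bs : List (Fin n)} → AllPairs Fin._>_ as → AllPairs Fin._>_ bs →
                 (∀ t → count≥ t as ≤ count≥ t bs) → DomList as bs
count≥⇒domList {as = []} _ _ _ = tt
count≥⇒domList {as = a ∷ as} {[]} _ _ as≤bs
  with () ← subst (_≤ 0) (count≥-∷-≤ {a = a} as ≤-refl) (as≤bs (toℕ a))
count≥⇒domList {as = a ∷ as} {b ∷ bs} as↓@(_ ∷ as↓′) bs↓@(_ ∷ bs↓′) as≤bs =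
  a≤b , count≥⇒domList as↓′ bs↓′ tails≤
  where
  a≤b : toℕ a ≤ toℕ b
  a≤b with toℕ a ≤? toℕ b
  ... | yes a≤b = a≤b
  ... | no  a≰b with () ← subst₂ _≤_ (count≥-∷-≤ {a = a} as ≤-refl)
                                    (trans (count≥-∷-> {a = b} bs (≰⇒> a≰b)) (count≥-below-head bs↓ (≰⇒> a≰b)))
                                    (as≤bs (toℕ a))
  tails≤ : ∀ t → count≥ t as ≤ count≥ t bs
  tails≤ t with t ≤? toℕ a
  ... | yes t≤a = s≤s⁻¹ (subst₂ _≤_ (count≥-∷-≤ {a = a} as t≤a) (count≥-∷-≤ {a = b} bs (≤-trans t≤a a≤b)) (as≤bs t))
  ... | no  t≰a = ≤-trans (≤-reflexive (count≥-below-head as↓ (≰⇒> t≰a))) z≤n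

elemsDesc-inside : (p : Subset n) → elemsDesc (inside ∷ p) ≡ List.map Fin.suc (elemsDesc p) ++ [ Fin.zero ]
elemsDesc-inside p = trans (unfold-reverse Fin.zero (List.map Fin.suc (elemsAsc p)))
                           (cong (_++ [ Fin.zero ]) (sym (reverse-map Fin.suc (elemsAsc p))))

elemsDesc-outside : (p : Subset n) → elemsDesc (outside ∷ p) ≡ List.map Fin.suc (elemsDesc p)
elemsDesc-outside p = sym (reverse-map Fin.suc (elemsAsc p))

elemsDesc-sorted : (p : Subset n) → AllPairs Fin._>_ (elemsDesc p)
elemsDesc-sorted []            = []
elemsDesc-sorted (inside ∷ p)  rewrite elemsDesc-inside p =
  AllPairs.++⁺ (AllPairs.map⁺ (AllPairs.map s<s (elemsDesc-sorted p))) ([] ∷ [])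
    (All.map⁺ (All.universal (λ _ → z<s ∷ []) (elemsDesc p)))
elemsDesc-sorted (outside ∷ p) rewrite elemsDesc-outside p =
  AllPairs.map⁺ (AllPairs.map s<s (elemsDesc-sorted p))

∣∣≥≡count≥ : (A : Subset n) (t : ℕ) → ∣ A ∣≥ t ≡ count≥ t (elemsDesc A)
∣∣≥≡count≥ [] t = refl
∣∣≥≡count≥ (outside ∷ A) t rewrite elemsDesc-outside A with t
... | zero  = trans (∣∣≥≡count≥ A zero) (sym (count≥-zero-map (elemsDesc A)))
... | suc t = trans (∣∣≥≡count≥ A t) (sym (count≥-suc-map t (elemsDesc A)))
∣∣≥≡count≥ (inside ∷ A) t rewrite elemsDesc-inside A | count≥-++ t (List.map Fin.suc (elemsDesc A)) [ Fin.zero ]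
  with t
... | zero  = trans (cong suc (trans (∣∣≥≡count≥ A zero) (sym (count≥-zero-map (elemsDesc A))))) (+-comm 1 _)
... | suc t = trans (∣∣≥≡count≥ A t) (sym (trans (+-identityʳ _) (count≥-suc-map t (elemsDesc A))))

-- A record rather than a Π-type, so that A and B can be inferred from A ⊑ B.
infix 4 _⊑_

record _⊑_ (A B : Subset n) : Set where
  constructor mk⊑
  field ≤-at : ∀ t → ∣ A ∣≥ t ≤ ∣ B ∣≥ t
open _⊑_

≽⇒⊑ : (A B : Subset n) → B ≽ A → A ⊑ B
≽⇒⊑ A B B≽A = mk⊑ λ t →
  subst₂ _≤_ (sym (∣∣≥≡count≥ A t)) (sym (∣∣≥≡count≥ B t)) (domList⇒count≥ (elemsDesc-sorted A) B≽A t)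

⊑⇒≽ : (A B : Subset n) → A ⊑ B → B ≽ A
⊑⇒≽ A B A⊑B = count≥⇒domList (elemsDesc-sorted A) (elemsDesc-sorted B)
  (λ t → subst₂ _≤_ (∣∣≥≡count≥ A t) (∣∣≥≡count≥ B t) (≤-at A⊑B t))

dec-true⁻¹ : {P : Set} (P? : Dec P) → does P? ≡ true → P
dec-true⁻¹ (yes p) _ = p

⟨⟩-wins⇒⊑ : (A B : Subset n) → ⟨ A ⟩ B ≡ true → A ⊑ B
⟨⟩-wins⇒⊑ A B wins = ≽⇒⊑ A B (dec-true⁻¹ (domList? (elemsDesc A) (elemsDesc B)) wins)

⊑⇒⟨⟩-wins : (A B : Subset n) → A ⊑ B → ⟨ A ⟩ B ≡ true
⊑⇒⟨⟩-wins A B A⊑B = dec-true (domList? (elemsDesc A) (elemsDesc B)) (⊑⇒≽ A B A⊑B)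

⊑-refl : {A : Subset n} → A ⊑ A
⊑-refl = mk⊑ λ t → ≤-refl

⊑-trans : {A B C : Subset n} → A ⊑ B → B ⊑ C → A ⊑ C
⊑-trans A⊑B B⊑C = mk⊑ λ t → ≤-trans (≤-at A⊑B t) (≤-at B⊑C t)

⊆⇒⊑ : {A B : Subset n} → A ⊆ B → A ⊑ B
⊆⇒⊑ A⊆B = mk⊑ (∣∣≥-mono-⊆ A⊆B)

tail-⊑ : {a b : Bool} {A B : Subset n} → (a ∷ A) ⊑ (b ∷ B) → A ⊑ B
tail-⊑ A⊑B = mk⊑ (≤-at A⊑B ∘ suc)

weight : Subset n → ℕ
weight []           = 0
weight A@(_ ∷ A′) = ∣ A ∣≥ 0 + weight A′

weight-mono : {A B : Subset n} → A ⊑ B → weight A ≤ weight B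
weight-mono {A = []}    {[]}    _   = z≤n
weight-mono {A = _ ∷ _} {_ ∷ _} A⊑B = +-mono-≤ (≤-at A⊑B 0) (weight-mono (tail-⊑ A⊑B))

+-≤-≡⇒≡ : {x y u v : ℕ} → x ≤ y → u ≤ v → x + u ≡ y + v → x ≡ y × u ≡ v
+-≤-≡⇒≡ {x} {y} {u} {v} x≤y u≤v eq = x≡y , +-cancelˡ-≡ y u v (trans (cong (_+ u) (sym x≡y)) eq)
  where
  x≡y : x ≡ y
  x≡y = ≤-antisym x≤y (+-cancelʳ-≤ v y x (≤-trans (≤-reflexive (sym eq)) (+-monoʳ-≤ x u≤v)))

∷-injective-∣∣≥ : {a b : Bool} (A : Subset n) → ∣ a ∷ A ∣≥ 0 ≡ ∣ b ∷ A ∣≥ 0 → a ≡ b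
∷-injective-∣∣≥ {a = inside}  {inside}  A _  = refl
∷-injective-∣∣≥ {a = outside} {outside} A _  = refl
∷-injective-∣∣≥ {a = inside}  {outside} A eq = ⊥-elim (1+n≢n eq)
∷-injective-∣∣≥ {a = outside} {inside}  A eq = ⊥-elim (1+n≢n (sym eq))

⊑-weight-injective : {A B : Subset n} → A ⊑ B → weight A ≡ weight B → A ≡ B
⊑-weight-injective {A = []}    {[]}    _   _  = refl
⊑-weight-injective {A = a ∷ A} {b ∷ B} A⊑B eq
  with heads , tails ← +-≤-≡⇒≡ (≤-at A⊑B 0) (weight-mono (tail-⊑ A⊑B)) eq
  with refl ← ⊑-weight-injective (tail-⊑ A⊑B) tails
  = cong (_∷ A) (∷-injective-∣∣≥ A heads)

⊑-antisym : {A B : Subset n} → A ⊑ B → B ⊑ A → A ≡ B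
⊑-antisym A⊑B B⊑A = ⊑-weight-injective A⊑B (≤-antisym (weight-mono A⊑B) (weight-mono B⊑A))

⊑-weight-< : {A B : Subset n} → A ⊑ B → A ≢ B → weight A < weight B
⊑-weight-< A⊑B A≢B = ≤∧≢⇒< (weight-mono A⊑B) (A≢B ∘ ⊑-weight-injective A⊑B)

module _ (A : Subset n) where

  ⟨⟩-isLinearGame : ⟨ A ⟩ ⊥ ≡ false → IsLinearGame ⟨ A ⟩
  ⟨⟩-isLinearGame ⊥-loses = (⊑⇒⟨⟩-wins A ⊤ (⊆⇒⊑ ⊆⊤) , ⊥-loses , ⊆-closed) , ≽-closed
    where
    ⊆-closed : ∀ S T → S ⊆ T → ⟨ A ⟩ S ≡ true → ⟨ A ⟩ T ≡ true
    ⊆-closed S T S⊆T S-wins = ⊑⇒⟨⟩-wins A T (⊑-trans (⟨⟩-wins⇒⊑ A S S-wins) (⊆⇒⊑ S⊆T))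
    ≽-closed : ∀ S T → T ≽ S → ⟨ A ⟩ S ≡ true → ⟨ A ⟩ T ≡ true
    ≽-closed S T T≽S S-wins = ⊑⇒⟨⟩-wins A T (⊑-trans (⟨⟩-wins⇒⊑ A S S-wins) (≽⇒⊑ S T T≽S))

  ⟨⟩-hasExactlyOneShiftMinimalWinning : HasExactlyOneShiftMinimalWinning ⟨ A ⟩
  ⟨⟩-hasExactlyOneShiftMinimalWinning = A , (A-wins , A-minimal) , unique
    where
    A-wins : ⟨ A ⟩ A ≡ true
    A-wins = ⊑⇒⟨⟩-wins A A ⊑-refl
    A-minimal : ∀ B → ⟨ A ⟩ B ≡ true → A ≽ B → B ≡ A
    A-minimal B B-wins A≽B = ⊑-antisym (≽⇒⊑ B A A≽B) (⟨⟩-wins⇒⊑ A B B-wins)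
    unique : ∀ B → IsShiftMinimalWinning ⟨ A ⟩ B → B ≡ A
    unique B (B-wins , B-minimal) = sym (B-minimal A A-wins (⊑⇒≽ A B (⟨⟩-wins⇒⊑ A B B-wins)))

⟨⟩-injective : {A B : Subset n} → ⟨ A ⟩ ≐ ⟨ B ⟩ → A ≡ B
⟨⟩-injective {A = A} {B} ⟨A⟩≐⟨B⟩ = ⊑-antisym
  (⟨⟩-wins⇒⊑ A B (trans (⟨A⟩≐⟨B⟩ B) (⊑⇒⟨⟩-wins B B ⊑-refl)))
  (⟨⟩-wins⇒⊑ B A (trans (sym (⟨A⟩≐⟨B⟩ A)) (⊑⇒⟨⟩-wins A A ⊑-refl)))

proper⇒⊥-loses : (A : Subset n) → IsProper ⟨ A ⟩ → ⟨ A ⟩ ⊥ ≡ false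
proper⇒⊥-loses A proper = Bool.¬-not λ ⊥-wins →
  proper ⊥ ⊥-wins (⊑⇒⟨⟩-wins A (∁ ⊥)
                    (⊑-trans (⟨⟩-wins⇒⊑ A ⊥ ⊥-wins) (⊆⇒⊑ ⊥⊆)))

isProper-resp-≐ : {F G : Family n} → F ≐ G → IsProper F → IsProper G
isProper-resp-≐ F≐G proper S S-wins ∁S-wins = proper S (trans (F≐G S) S-wins) (trans (F≐G (∁ S)) ∁S-wins)

shiftMinimalWinning-below : (F : Family n) {S : Subset n} → F S ≡ true →
                            ∃[ B ] IsShiftMinimalWinning F B × S ≽ B
shiftMinimalWinning-below F {S} = descend S (<-wellFounded (weight S))
  where
  descend : ∀ S → Acc _<_ (weight S) → F S ≡ true → ∃[ B ] IsShiftMinimalWinning F B × S ≽ B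
  descend S (acc smaller) S-wins
    with anySubset? (λ T → (F T Bool.≟ true) ×-dec domList? (elemsDesc T) (elemsDesc S)
                                               ×-dec ¬? (≡-dec Bool._≟_ T S))
  ... | yes (T , T-wins , S≽T , T≢S) =
    let T⊑S = ≽⇒⊑ T S S≽T
        B , B-minimal , T≽B = descend T (smaller (⊑-weight-< T⊑S T≢S)) T-wins
    in B , B-minimal , ⊑⇒≽ B S (⊑-trans (≽⇒⊑ B T T≽B) T⊑S)
  ... | no ∄T = S , (S-wins , S-minimal) , ⊑⇒≽ S S ⊑-refl
    where
    S-minimal : ∀ B → F B ≡ true → S ≽ B → B ≡ S
    S-minimal B B-wins S≽B =
      decidable-stable (≡-dec Bool._≟_ B S) (λ B≢S → ∄T (B , B-wins , S≽B , B≢S))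

linearGame-≐⟨shiftMinimal⟩ : {F : Family n} → IsLinearGame F → (one : HasExactlyOneShiftMinimalWinning F) →
                             F ≐ ⟨ proj₁ one ⟩
linearGame-≐⟨shiftMinimal⟩ {F = F} (_ , ≽-closed) (A , (A-wins , _) , unique) S =
  Bool.⇔→≡ (mk⇔ F-wins⇒ ⟨A⟩-wins⇒)
  where
  F-wins⇒ : F S ≡ true → ⟨ A ⟩ S ≡ true
  F-wins⇒ S-wins with B , B-minimal , S≽B ← shiftMinimalWinning-below F S-wins
                 with refl ← unique B B-minimal =
    dec-true (domList? (elemsDesc A) (elemsDesc S)) S≽B
  ⟨A⟩-wins⇒ : ⟨ A ⟩ S ≡ true → F S ≡ true
  ⟨A⟩-wins⇒ S-wins = ≽-closed A S (dec-true⁻¹ (domList? (elemsDesc A) (elemsDesc S)) S-wins) A-wins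

2*-≤-+ : {a x y : ℕ} → a ≤ x → a ≤ y → 2 * a ≤ x + y
2*-≤-+ {a} a≤x a≤y = +-mono-≤ a≤x (≤-trans (≤-reflexive (+-identityʳ a)) a≤y)

half-≤ : {a c : ℕ} → 2 * a ≤ suc c + c → a ≤ c
half-≤ {a} {c} 2a≤ = ≮⇒≥ λ c<a → <-irrefl refl (begin-strict
  suc c + c      <⟨ +-monoʳ-< (suc c) (n<1+n c) ⟩
  suc c + suc c  ≤⟨ +-mono-≤ c<a c<a ⟩
  a + a          ≡⟨ cong (a +_) (+-identityʳ a) ⟨
  2 * a          ≤⟨ 2a≤ ⟩
  suc c + c      ∎)
  where open ≤-Reasoning

Balanced : Subset n → Set
Balanced {n} A = ∀ t → 2 * ∣ A ∣≥ t ≤ n ∸ t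

balanced-∷ : {b : Bool} {A : Subset n} → Balanced (b ∷ A) ⇔ (2 * ∣ b ∷ A ∣≥ 0 ≤ suc n × Balanced A)
balanced-∷ = mk⇔ (λ bal → bal 0 , bal ∘ suc) λ where
  (h , bal) zero    → h
  (h , bal) (suc t) → bal t

balanced-outside∷ : {A : Subset n} → Balanced (outside ∷ A) ⇔ Balanced A
balanced-outside∷ {n} = mk⇔ (λ bal → bal ∘ suc)
  (λ bal → Equivalence.from balanced-∷ (≤-trans (bal 0) (n≤1+n n) , bal))

balanced? : Decidable (Balanced {n})
balanced? []      = yes λ t → z≤n
balanced? (b ∷ A) = Dec.map (⇔.sym balanced-∷) ((2 * ∣ b ∷ A ∣≥ 0 ≤? _) ×-dec balanced? A)

¬balanced⇒majority : (A : Subset n) → ¬ Balanced A → ∃[ t ] n ∸ t < 2 * ∣ A ∣≥ t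
¬balanced⇒majority []      ¬bal = ⊥-elim (¬bal λ t → z≤n)
¬balanced⇒majority {suc n} (b ∷ A) ¬bal with 2 * ∣ b ∷ A ∣≥ 0 ≤? suc n
... | no  h = 0 , ≰⇒> h
... | yes h with t , maj ← ¬balanced⇒majority A (λ bal → ¬bal (Equivalence.from balanced-∷ (h , bal))) =
  suc t , maj

majority⇒proper : (A : Subset n) {t : ℕ} → n ∸ t < 2 * ∣ A ∣≥ t → IsProper ⟨ A ⟩
majority⇒proper {n} A {t} maj S S-wins ∁S-wins = <⇒≱ maj (begin
  2 * ∣ A ∣≥ t            ≤⟨ 2*-≤-+ (≤-at (⟨⟩-wins⇒⊑ A S S-wins) t)
                                     (≤-at (⟨⟩-wins⇒⊑ A (∁ S) ∁S-wins) t) ⟩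
  ∣ S ∣≥ t + ∣ ∁ S ∣≥ t   ≡⟨ ∣∣≥+∣∁∣≥ S t ⟩
  n ∸ t                   ∎)
  where open ≤-Reasoning

∃-nearlyHalving : ∀ n → Σ (Subset n) λ S → (∀ t → ∣ ∁ S ∣≥ t ≤ ∣ S ∣≥ t × ∣ S ∣≥ t ≤ suc (∣ ∁ S ∣≥ t))
∃-nearlyHalving zero = [] , λ t → z≤n , z≤n
∃-nearlyHalving (suc n) with S , halves ← ∃-nearlyHalving n | ∣ S ∣≥ 0 ≟ ∣ ∁ S ∣≥ 0
... | yes S≡∁S = inside ∷ S , λ where
  zero    → m≤n⇒m≤1+n (proj₁ (halves 0)) , s≤s (≤-reflexive S≡∁S)
  (suc t) → halves t
... | no  S≢∁S = outside ∷ S , λ where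
  zero    → ≤∧≢⇒< (proj₁ (halves 0)) (S≢∁S ∘ sym) , m≤n⇒m≤1+n (proj₂ (halves 0))
  (suc t) → halves t

balanced⇒¬proper : (A : Subset n) → Balanced A → ¬ IsProper ⟨ A ⟩
balanced⇒¬proper {n} A balanced proper with S , halves ← ∃-nearlyHalving n =
  proper S (⊑⇒⟨⟩-wins A S (⊑-trans A⊑∁S (mk⊑ λ t → proj₁ (halves t))))
           (⊑⇒⟨⟩-wins A (∁ S) A⊑∁S)
  where
  A⊑∁S : A ⊑ ∁ S
  A⊑∁S = mk⊑ λ t → half-≤ (begin
    2 * ∣ A ∣≥ t              ≤⟨ balanced t ⟩
    n ∸ t                     ≡⟨ ∣∣≥+∣∁∣≥ S t ⟨
    ∣ S ∣≥ t + ∣ ∁ S ∣≥ t     ≤⟨ +-monoˡ-≤ (∣ ∁ S ∣≥ t) (proj₂ (halves t)) ⟩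
    suc (∣ ∁ S ∣≥ t) + ∣ ∁ S ∣≥ t ∎)
    where open ≤-Reasoning

proper⇔majority : (A : Subset n) → IsProper ⟨ A ⟩ ⇔ (∃[ t ] n ∸ t < 2 * ∣ A ∣≥ t)
proper⇔majority A = mk⇔ (λ proper → ¬balanced⇒majority A (λ balanced → balanced⇒¬proper A balanced proper))
                        (λ (t , maj) → majority⇒proper A maj)

proper⇔¬balanced : (A : Subset n) → IsProper ⟨ A ⟩ ⇔ (¬ Balanced A)
proper⇔¬balanced A = mk⇔ (λ proper balanced → balanced⇒¬proper A balanced proper)
                         (λ ¬balanced → majority⇒proper A (proj₂ (¬balanced⇒majority A ¬balanced)))

<2*⇒1≤ : {m k : ℕ} → m < 2 * k → 1 ≤ k
<2*⇒1≤ {k = suc _} _ = s≤s z≤n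

<⇒≤∸1 : {m n : ℕ} → m < n → m ≤ n ∸ 1
<⇒≤∸1 (s≤s m≤n) = m≤n

∸-∸-≤ : (n t : ℕ) → n ∸ (n ∸ t) ≤ t
∸-∸-≤ n t = m≤n+o⇒m∸n≤o n (n ∸ t) (subst (n ≤_) (+-comm t (n ∸ t)) (m≤n+m∸n n t))

majority⇔largest : (A : Subset n) →
  (∃[ t ] n ∸ t < 2 * ∣ A ∣≥ t) ⇔ Σ ℕ (λ k → (1 ≤ k) × (k ≤ n) × (k ≤ ∣ A ∩ largest n (2 * k ∸ 1) ∣))
majority⇔largest {n} A = mk⇔
  (λ (t , maj) → ∣ A ∣≥ t , <2*⇒1≤ maj , ≤-trans (∣∣≥≤∸ A t) (m∸n≤m n t) ,
     subst (∣ A ∣≥ t ≤_) (sym (∣∩largest∣ A (2 * ∣ A ∣≥ t ∸ 1)))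
       (∣∣≥-antitone A (≤-trans (∸-monoʳ-≤ n (<⇒≤∸1 maj)) (∸-∸-≤ n t))))
  (λ (k , 1≤k , _ , k≤) → n ∸ (2 * k ∸ 1) , (begin-strict
     n ∸ (n ∸ (2 * k ∸ 1))    ≤⟨ ∸-∸-≤ n (2 * k ∸ 1) ⟩
     2 * k ∸ 1                <⟨ ∸-monoʳ-< z<s (≤-trans 1≤k (m≤m+n k _)) ⟩
     2 * k                    ≤⟨ *-monoʳ-≤ 2 (subst (k ≤_) (∣∩largest∣ A (2 * k ∸ 1)) k≤) ⟩
     2 * ∣ A ∣≥ (n ∸ (2 * k ∸ 1)) ∎))
  where open ≤-Reasoning

BalancedOfSize≤ : ℕ → Subset n → Set
BalancedOfSize≤ j A = Balanced A × ∣ A ∣≥ 0 ≤ j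

balancedOfSize≤? : ∀ j → Decidable (BalancedOfSize≤ {n} j)
balancedOfSize≤? j A = balanced? A ×-dec (∣ A ∣≥ 0 ≤? j)

ballots : (n j : ℕ) → ℕ
ballots n j = count (balancedOfSize≤? {n} j)

ballots-zero : ∀ n → ballots (suc n) 0 ≡ ballots n 0
ballots-zero n = cong₂ _+_
  (count-empty (balancedOfSize≤? {suc n} 0 ∘ (inside ∷_)) λ { _ (_ , ()) })
  (count-cong (balancedOfSize≤? {suc n} 0 ∘ (outside ∷_)) (balancedOfSize≤? {n} 0) λ A → mk⇔
    (λ (bal , size) → Equivalence.to balanced-outside∷ bal , size)
    (λ (bal , size) → Equivalence.from balanced-outside∷ bal , size))

ballots-suc : ∀ n j → 2 * suc j ≤ suc n → ballots (suc n) (suc j) ≡ ballots n j + ballots n (suc j)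
ballots-suc n j room = cong₂ _+_
  (count-cong (balancedOfSize≤? {suc n} (suc j) ∘ (inside ∷_)) (balancedOfSize≤? {n} j) λ A → mk⇔
    (λ (bal , size) → proj₂ (Equivalence.to balanced-∷ bal) , s≤s⁻¹ size)
    (λ (bal , size) → Equivalence.from balanced-∷ (≤-trans (*-monoʳ-≤ 2 (s≤s size)) room , bal) , s≤s size))
  (count-cong (balancedOfSize≤? {suc n} (suc j) ∘ (outside ∷_)) (balancedOfSize≤? {n} (suc j)) λ A → mk⇔
    (λ (bal , size) → Equivalence.to balanced-outside∷ bal , size)
    (λ (bal , size) → Equivalence.from balanced-outside∷ bal , size))

ballots-saturated : ∀ n j → n < 2 * suc j → ballots n (suc j) ≡ ballots n j
ballots-saturated n j full = count-cong (balancedOfSize≤? {n} (suc j)) (balancedOfSize≤? {n} j) λ A → mk⇔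
  (λ (bal , size) → bal , s≤s⁻¹ (*-cancelˡ-< 2 _ _ (≤-<-trans (bal 0) full)))
  (λ (bal , size) → bal , m≤n⇒m≤1+n size)

ballots≡C : ∀ n j → 2 * j ≤ n → ballots n j ≡ n C j
ballots≡C zero    zero    _    = refl
ballots≡C (suc n) zero    _    = trans (ballots-zero n) (ballots≡C n zero z≤n)
ballots≡C (suc n) (suc j) room = trans (ballots-suc n j room) (pascal (2 * suc j ≤? n))
  where
  room′ : 2 * j ≤ n
  room′ = ≤-trans (+-monoʳ-≤ j (n≤1+n (j + 0))) (s≤s⁻¹ room)
  pascal : Dec (2 * suc j ≤ n) → ballots n j + ballots n (suc j) ≡ suc n C suc j
  pascal (yes room″) = begin
    ballots n j + ballots n (suc j)   ≡⟨ cong₂ _+_ (ballots≡C n j room′) (ballots≡C n (suc j) room″) ⟩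
    n C j + n C suc j                 ≡⟨ nCk+nC[k+1]≡[n+1]C[k+1] n j ⟩
    suc n C suc j                     ∎
    where open ≡-Reasoning
  pascal (no full) = begin
    ballots n j + ballots n (suc j)   ≡⟨ cong (ballots n j +_) (ballots-saturated n j (≰⇒> full)) ⟩
    ballots n j + ballots n j         ≡⟨ cong₂ _+_ (ballots≡C n j room′) (ballots≡C n j room′) ⟩
    n C j + n C j                     ≡⟨ cong (n C j +_) middle ⟩
    n C j + n C suc j                 ≡⟨ nCk+nC[k+1]≡[n+1]C[k+1] n j ⟩
    suc n C suc j                     ∎
    where
    open ≡-Reasoning
    n≡j+suc[j+0] : n ≡ j + suc (j + 0)
    n≡j+suc[j+0] = ≤-antisym (s≤s⁻¹ (≰⇒> full)) (s≤s⁻¹ room)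
    n∸j≡suc[j] : n ∸ j ≡ suc j
    n∸j≡suc[j] = begin
      n ∸ j                   ≡⟨ cong (_∸ j) n≡j+suc[j+0] ⟩
      j + suc (j + 0) ∸ j     ≡⟨ m+n∸m≡n j (suc (j + 0)) ⟩
      suc (j + 0)             ≡⟨ cong suc (+-identityʳ j) ⟩
      suc j                   ∎
    middle : n C j ≡ n C suc j
    middle = trans (nCk≡nC[n∸k] (subst (j ≤_) (sym n≡j+suc[j+0]) (m≤m+n j _))) (cong (n C_) n∸j≡suc[j])

2*≤⇒≤/2 : {a m : ℕ} → 2 * a ≤ m → a ≤ m / 2
2*≤⇒≤/2 {a} {m} 2a≤m = subst (_≤ m / 2) (trans (cong (_/ 2) (*-comm 2 a)) (m*n/n≡m a 2)) (/-monoˡ-≤ 2 2a≤m)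

count-balanced : ∀ n → count (balanced? {n}) ≡ n C (n / 2)
count-balanced n = begin
  count (balanced? {n})   ≡⟨ count-cong balanced? (balancedOfSize≤? {n} (n / 2)) (λ A →
                               mk⇔ (λ bal → bal , 2*≤⇒≤/2 (bal 0)) proj₁) ⟩
  ballots n (n / 2)       ≡⟨ ballots≡C n (n / 2) (subst (_≤ n) (*-comm (n / 2) 2) (m/n*n≤m n 2)) ⟩
  n C (n / 2)             ∎
  where open ≡-Reasoning

count-¬balanced : ∀ n → count (¬? ∘ balanced? {n}) ≡ 2 ^ n ∸ n C (n / 2)
count-¬balanced n = begin
  count ¬bal?                        ≡⟨ m+n∸m≡n (count bal?) (count ¬bal?) ⟨
  count bal? + count ¬bal? ∸ count bal? ≡⟨ cong₂ _∸_ (count+count-¬≡2^n bal?) (count-balanced n) ⟩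
  2 ^ n ∸ n C (n / 2)                ∎
  where
  open ≡-Reasoning
  bal? = balanced? {n}
  ¬bal? = ¬? ∘ bal?

theorem3p13 :
    (∀ (n : ℕ) →
      HasCount {n} (λ W → IsLinearGame W × IsProper W × HasExactlyOneShiftMinimalWinning W)
        (2 ^ n ∸ n C (n / 2)))
    ×
    (∀ (n : ℕ) (A : Subset n) →
      IsProper ⟨ A ⟩ ⇔ Σ ℕ (λ k → (1 ≤ k) × (k ≤ n) × (k ≤ ∣ A ∩ largest n (2 * k ∸ 1) ∣)))
theorem3p13 = counting , λ n A → ⇔.trans (proper⇔majority A) (majority⇔largest A)
  where
  Counted : {n : ℕ} → Family n → Set
  Counted W = IsLinearGame W × IsProper W × HasExactlyOneShiftMinimalWinning W

  counting : ∀ n → HasCount {n} Counted (2 ^ n ∸ n C (n / 2))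
  counting n = subst (HasCount Counted) (count-¬balanced n)
    (hasCount-parametrised (¬? ∘ balanced?) ⟨_⟩ (λ {A} → principal {A}) (λ {A} {B} → ⟨⟩-injective {A = A} {B}) unprincipal)
    where
    principal : {A : Subset n} → ¬ Balanced A → Counted ⟨ A ⟩
    principal {A} ¬balanced = ⟨⟩-isLinearGame A (proper⇒⊥-loses A proper) , proper ,
                              ⟨⟩-hasExactlyOneShiftMinimalWinning A
      where proper = Equivalence.from (proper⇔¬balanced A) ¬balanced
    unprincipal : ∀ F → Counted F → ∃[ A ] ¬ Balanced A × F ≐ ⟨ A ⟩
    unprincipal F (linear , proper , one@(A , _)) =
      A , Equivalence.to (proper⇔¬balanced A) (isProper-resp-≐ F≐⟨A⟩ proper) , F≐⟨A⟩
      where F≐⟨A⟩ = linearGame-≐⟨shiftMinimal⟩ linear one
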